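{- Let $X$ be a finite set, $\hat S=(s_i)_{i\in I}$ a finite sequence of subsets of $X$, and $\tau:X\to I$ a correspondence. A function $f:X\to\{0,1,2\}$ is a minimal Roman hitting function if and only if all of the following hold: (0) for all $x,y\in f^{ -1}(1)$ with $x\ne y$, $\tau(x)\ne\tau(y)$; (1) for all $x\in f^{ -1}(1)$, $s_{\tau(x)}\cap f^{ -1}(2)=\emptyset$; (2) for every $x\in f^{ -1}(2)$ there exists $i\in I\setminus\{\tau(x)\}$ with $s_i\cap f^{ -1}(2)=\{x\}$; (3) $f^{ -1}(2)$ is a minimal hitting set of the family $\{s_i : i\in I,\ \tau^{ -1}(i)\cap f^{ -1}(1)=\emptyset\}$.
   Context: A correspondence is a map $\tau:X\to I$ with $x\in s_{\tau(x)}$ for all $x\in X$. A function $f:X\to\{0,1,2\}$ is a Roman hitting function (rhf) if for every $i\in I$ there is $x\in s_i$ with $f(x)=2$ or there is $x\in X$ with $\tau(x)=i$ and $f(x)=1$. Functions are ordered pointwise ($g\le f$ iff $g(x)\le f(x)$ for all $x$); an rhf $f$ is minimal if every rhf $g\le f$ equals $f$. A hitting set of a family of subsets of $X$ is a set meeting every member; it is minimal if no proper subset is a hitting set. -}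

module Defs where

open import Data.Nat using (ℕ)
open import Data.Fin using (Fin; zero; suc)
open import Data.Fin.Subset using (Subset; _∈_; _∉_; _⊆_; _⊂_)
open import Data.Product using (Σ; ∃; ∃-syntax; _×_; _,_)
open import Data.Sum using (_⊎_)
open import Relation.Binary.PropositionalEquality using (_≡_; _≢_)
open import Relation.Nullary using (¬_)

IsCorrespondence : ∀ {n m} → (Fin m → Subset n) → (Fin n → Fin m) → Set
IsCorrespondence s τ = ∀ x → x ∈ s (τ x)

IsRHF : ∀ {n m} → (Fin m → Subset n) → (Fin n → Fin m) → (Fin n → Fin 3) → Set
IsRHF {n} s τ f =
  ∀ i → (∃[ x ] (x ∈ s i × f x ≡ suc (suc zero)))
      ⊎ (∃[ x ] (τ x ≡ i × f x ≡ suc zero))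

_≤F_ : ∀ {n} → (Fin n → Fin 3) → (Fin n → Fin 3) → Set
g ≤F f = ∀ x → Data.Fin._≤_ (g x) (f x)

IsMinimalRHF : ∀ {n m} → (Fin m → Subset n) → (Fin n → Fin m) → (Fin n → Fin 3) → Set
IsMinimalRHF s τ f =
  IsRHF s τ f × (∀ g → IsRHF s τ g → g ≤F f → ∀ x → g x ≡ f x)

IsHittingSet : ∀ {n m} → (Fin m → Subset n) → (Fin m → Set) → Subset n → Set
IsHittingSet s P H = ∀ i → P i → ∃[ x ] (x ∈ s i × x ∈ H)

IsMinimalHittingSet : ∀ {n m} → (Fin m → Subset n) → (Fin m → Set) → Subset n → Set
IsMinimalHittingSet s P H =
  IsHittingSet s P H × (∀ H' → H' ⊂ H → ¬ IsHittingSet s P H')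

preimage2 : ∀ {n} → (Fin n → Fin 3) → Subset n
preimage2 {n} f = Data.Vec.tabulate (λ x → is2 (f x))
  where
  open import Data.Bool using (Bool; true; false)
  import Data.Vec
  is2 : Fin 3 → Bool
  is2 (suc (suc zero)) = true
  is2 _ = false

{-# OPTIONS --safe #-}
module Submission where

-- Minimality is tested by lowering values. A 1 at x can be dropped to 0 exactly when τ x stays
-- covered, by a 2 in s (τ x) or by another 1 at τ x, which (0) and (1) rule out. A 2 at x can be
-- dropped to 1 unless some s i with i ≠ τ x is hit by x alone, which is (2). Turning the 2s outside
-- a smaller hitting set H ⊂ f⁻¹(2) into 0s still gives an rhf, which (3) forbids. Conversely, under
-- (0)–(2) every rhf g ≤ f keeps each 1 and each 2 of f, and the hitting part of (3) makes f an rhf.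

open import Defs
open import Data.Nat using (ℕ; z<s; s<s; s≤s; z≤n)
open import Data.Bool using (true; false; if_then_else_)
open import Data.Fin using (Fin; zero; suc; _≟_; _≤_; _<_)
open import Data.Fin.Subset using (Subset; _∈_; _∉_; _⊆_; _⊂_)
open import Data.Fin.Subset.Properties using (_∈?_)
open import Data.Fin.Properties using (any?; ¬∀⟶∃¬; ≤-refl; <⇒≢)
open import Data.Nat.Properties using (<⇒≤)
open import Data.Vec using (lookup)
open import Data.Vec.Properties using (lookup∘tabulate; []=⇒lookup; lookup⇒[]=)
open import Data.Vec.Functional using (updateAt)
open import Data.Vec.Functional.Properties using (updateAt-updates; updateAt-minimal)
open import Data.Product using (∃-syntax; _×_; _,_; proj₁; proj₂; map₂)
open import Data.Sum using (_⊎_; inj₁; inj₂)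
open import Data.Empty using (⊥-elim)
open import Function using (const; _∋_)
open import Function.Bundles using (_⇔_; mk⇔; Equivalence)
open import Relation.Nullary using (¬_; Dec; does; yes; no)
open import Relation.Nullary.Decidable using (_×-dec_; _⊎-dec_)
open import Relation.Binary.PropositionalEquality
  using (_≡_; _≢_; refl; sym; trans; subst; module ≡-Reasoning)

pattern one = suc zero
pattern two = suc (suc zero)

≤-zero : {a b : Fin 3} → a ≤ b → b ≡ zero → a ≡ zero
≤-zero {zero} _ _ = refl
≤-zero {suc _} {zero} () _

≤-one : {a b : Fin 3} → a ≤ b → a ≡ one → b ≡ one ⊎ b ≡ two
≤-one {b = one} _ refl = inj₁ refl
≤-one {b = two} _ refl = inj₂ refl

≤-two : {a b : Fin 3} → a ≤ b → a ≡ two → b ≡ two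
≤-two {b = two} _ refl = refl
≤-two {b = one} (s≤s ()) refl

distinct-values⇒≢ : ∀ {n} {f : Fin n → Fin 3} {x y a b} → f x ≡ a → f y ≡ b → a ≢ b → x ≢ y
distinct-values⇒≢ fx fy a≢b refl = a≢b (trans (sym fx) fy)

-- The indicator inside preimage2 is local to Defs, so it is only reached through lookup∘tabulate.
∈-preimage2⁺ : ∀ {n} {f : Fin n → Fin 3} {x} → f x ≡ two → x ∈ preimage2 f
∈-preimage2⁺ {f = f} {x} fx with f x | fx | (lookup (preimage2 f) x ≡ _ ∋ lookup∘tabulate _ x)
... | two | refl | p = lookup⇒[]= x (preimage2 f) p

∈-preimage2⁻ : ∀ {n} {f : Fin n → Fin 3} {x} → x ∈ preimage2 f → f x ≡ two
∈-preimage2⁻ {f = f} {x} x∈ with f x | trans (sym (lookup∘tabulate _ x)) ([]=⇒lookup x∈)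
... | two | _ = refl
... | zero | ()
... | one | ()

infix 25 _[_≔_]
_[_≔_] : ∀ {a} {A : Set a} {n} → (Fin n → A) → Fin n → A → Fin n → A
f [ x ≔ v ] = updateAt f x (const v)

[≔]-≤F : ∀ {n} (f : Fin n → Fin 3) {x v} → v ≤ f x → f [ x ≔ v ] ≤F f
[≔]-≤F f {x} v≤fx y with y ≟ x
... | yes refl = subst (_≤ f y) (sym (updateAt-updates y f)) v≤fx
... | no y≢x = subst (_≤ f y) (sym (updateAt-minimal y x f y≢x)) ≤-refl

dropTwo : Fin 3 → Fin 3
dropTwo two = zero
dropTwo v = v

shrinkTwos : ∀ {n} → Subset n → (Fin n → Fin 3) → Fin n → Fin 3
shrinkTwos H f y = if does (y ∈? H) then f y else dropTwo (f y)

module _ {n} (H : Subset n) (f : Fin n → Fin 3) where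

  shrinkTwos-≤F : shrinkTwos H f ≤F f
  shrinkTwos-≤F y with does (y ∈? H) | f y
  ... | true | _ = ≤-refl
  ... | false | zero = z≤n
  ... | false | one = s≤s z≤n
  ... | false | two = z≤n

  shrinkTwos-one : ∀ {y} → f y ≡ one → shrinkTwos H f y ≡ one
  shrinkTwos-one {y} fy with does (y ∈? H) | f y
  ... | true | _ = fy
  ... | false | one = refl

  shrinkTwos-∈ : ∀ {y} → H ⊆ preimage2 f → y ∈ H → shrinkTwos H f y ≡ two
  shrinkTwos-∈ {y} H⊆ y∈H with y ∈? H
  ... | yes _ = ∈-preimage2⁻ (H⊆ y∈H)
  ... | no y∉H = ⊥-elim (y∉H y∈H)

  shrinkTwos-∉ : ∀ {y} → f y ≡ two → y ∉ H → shrinkTwos H f y ≡ zero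
  shrinkTwos-∉ {y} fy y∉H with y ∈? H | f y
  ... | yes y∈H | _ = ⊥-elim (y∉H y∈H)
  ... | no _ | two = refl

module _ {n m : ℕ} (s : Fin m → Subset n) (τ : Fin n → Fin m) where

  Hit : (Fin n → Fin 3) → Fin m → Set
  Hit f i = ∃[ x ] (x ∈ s i × f x ≡ two)

  Served : (Fin n → Fin 3) → Fin m → Set
  Served f i = ∃[ x ] (τ x ≡ i × f x ≡ one)

  Unserved : (Fin n → Fin 3) → Fin m → Set
  Unserved f i = ∀ x → τ x ≡ i → f x ≢ one

  Covered : (Fin n → Fin 3) → Fin m → Set
  Covered f i = Hit f i ⊎ Served f i

  served? : ∀ f i → Dec (Served f i)
  served? f i = any? (λ x → (τ x ≟ i) ×-dec (f x ≟ one))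

  covered? : ∀ f i → Dec (Covered f i)
  covered? f i = any? (λ x → (x ∈? s i) ×-dec (f x ≟ two)) ⊎-dec served? f i

  rhf⇒twos-hitting : ∀ {f} → IsRHF s τ f → IsHittingSet s (Unserved f) (preimage2 f)
  rhf⇒twos-hitting rhf i unserved with rhf i
  ... | inj₁ (x , x∈ , fx) = x , x∈ , ∈-preimage2⁺ fx
  ... | inj₂ (x , τx , fx) = ⊥-elim (unserved x τx fx)

  hitting⇒rhf : ∀ {f H} → (∀ {x} → x ∈ H → f x ≡ two) → IsHittingSet s (Unserved f) H → IsRHF s τ f
  hitting⇒rhf {f} H-twos hitting i with served? f i
  ... | yes served = inj₂ served
  ... | no unserved with hitting i (λ x τx fx → unserved (x , τx , fx))
  ...   | x , x∈ , x∈H = inj₁ (x , x∈ , H-twos x∈H)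

  minimal⇒lowering-not-rhf : ∀ {f x b v} → IsMinimalRHF s τ f → f x ≡ b → v < b → ¬ IsRHF s τ (f [ x ≔ v ])
  minimal⇒lowering-not-rhf {f} {x} {b} {v} (_ , minimal) fx v<b rhf = <⇒≢ v<b (begin
    v               ≡⟨ updateAt-updates x f ⟨
    (f [ x ≔ v ]) x ≡⟨ minimal _ rhf ([≔]-≤F f (subst (v ≤_) (sym fx) (<⇒≤ v<b))) x ⟩
    f x             ≡⟨ fx ⟩
    b               ∎)
    where open ≡-Reasoning

  zeroing-redundant-one : ∀ {f x} → IsRHF s τ f → f x ≡ one →
    Covered (f [ x ≔ zero ]) (τ x) → IsRHF s τ (f [ x ≔ zero ])
  zeroing-redundant-one {f} {x} rhf fx τx-covered i with rhf i
  ... | inj₁ (y , y∈ , fy) = inj₁ (y , y∈ , trans (updateAt-minimal y x f (distinct-values⇒≢ fy fx λ ())) fy)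
  ... | inj₂ (y , τy , fy) with y ≟ x
  ...   | yes refl = subst (Covered _) τy τx-covered
  ...   | no y≢x = inj₂ (y , τy , trans (updateAt-minimal y x f y≢x) fy)

  uncovered⇒private : ∀ {f x i} → IsRHF s τ f → f x ≡ two → ¬ Covered (f [ x ≔ one ]) i →
    i ≢ τ x × (∀ y → (y ∈ s i × f y ≡ two) ⇔ (y ≡ x))
  uncovered⇒private {f} {x} {i} rhf fx uncovered = i≢τx , λ y → mk⇔ only-x (λ { refl → x-hits })
    where
    i≢τx : i ≢ τ x
    i≢τx refl = uncovered (inj₂ (x , refl , updateAt-updates x f))

    only-x : ∀ {y} → y ∈ s i × f y ≡ two → y ≡ x
    only-x {y} (y∈ , fy) with y ≟ x
    ... | yes y≡x = y≡x
    ... | no y≢x = ⊥-elim (uncovered (inj₁ (y , y∈ , trans (updateAt-minimal y x f y≢x) fy)))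

    x-hits : x ∈ s i × f x ≡ two
    x-hits with rhf i
    ... | inj₁ (y , y-hits) with only-x y-hits
    ...   | refl = y-hits
    x-hits | inj₂ (y , τy , fy) =
      ⊥-elim (uncovered (inj₂ (y , τy , trans (updateAt-minimal y x f (distinct-values⇒≢ fy fx λ ())) fy)))

  shrinkTwos-rhf : ∀ {f H} → H ⊆ preimage2 f → IsHittingSet s (Unserved f) H → IsRHF s τ (shrinkTwos H f)
  shrinkTwos-rhf {f} {H} H⊆ hitting = hitting⇒rhf (shrinkTwos-∈ H f H⊆)
    (λ i unserved → hitting i (λ y τy fy → unserved y τy (shrinkTwos-one H f fy)))

  module _ {f : Fin n → Fin 3} (minimal : IsMinimalRHF s τ f) where

    private
      rhf : IsRHF s τ f
      rhf = proj₁ minimal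

    minimal⇒ones-distinct-indices : ∀ x y → f x ≡ one → f y ≡ one → x ≢ y → τ x ≢ τ y
    minimal⇒ones-distinct-indices x y fx fy x≢y τx≡τy = minimal⇒lowering-not-rhf minimal fy z<s
      (zeroing-redundant-one rhf fy (inj₂ (x , τx≡τy , trans (updateAt-minimal x y f x≢y) fx)))

    minimal⇒ones-sets-avoid-twos : ∀ x → f x ≡ one → ∀ y → y ∈ s (τ x) → f y ≢ two
    minimal⇒ones-sets-avoid-twos x fx y y∈ fy = minimal⇒lowering-not-rhf minimal fx z<s
      (zeroing-redundant-one rhf fx
        (inj₁ (y , y∈ , trans (updateAt-minimal y x f (distinct-values⇒≢ fy fx λ ())) fy)))

    minimal⇒twos-have-private-sets : ∀ x → f x ≡ two →
      ∃[ i ] (i ≢ τ x × (∀ y → (y ∈ s i × f y ≡ two) ⇔ (y ≡ x)))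
    minimal⇒twos-have-private-sets x fx = map₂ (uncovered⇒private rhf fx)
      (¬∀⟶∃¬ m _ (covered? _) (minimal⇒lowering-not-rhf minimal fx (s<s z<s)))

    minimal⇒twos-minimal-hitting : IsMinimalHittingSet s (Unserved f) (preimage2 f)
    minimal⇒twos-minimal-hitting = rhf⇒twos-hitting rhf , smaller-not-hitting
      where
      smaller-not-hitting : ∀ H → H ⊂ preimage2 f → ¬ IsHittingSet s (Unserved f) H
      smaller-not-hitting H (H⊆ , x , x∈ , x∉H) hitting = <⇒≢ z<s (begin
        zero             ≡⟨ shrinkTwos-∉ H f fx x∉H ⟨
        shrinkTwos H f x ≡⟨ proj₂ minimal _ (shrinkTwos-rhf H⊆ hitting) (shrinkTwos-≤F H f) x ⟩
        f x              ≡⟨ fx ⟩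
        two              ∎)
        where
        open ≡-Reasoning
        fx : f x ≡ two
        fx = ∈-preimage2⁻ x∈

  module _ (corr : IsCorrespondence s τ) {f : Fin n → Fin 3}
    (ones-distinct : ∀ x y → f x ≡ one → f y ≡ one → x ≢ y → τ x ≢ τ y)
    (ones-avoid-twos : ∀ x → f x ≡ one → ∀ y → y ∈ s (τ x) → f y ≢ two)
    (twos-private : ∀ x → f x ≡ two → ∃[ i ] (i ≢ τ x × (∀ y → (y ∈ s i × f y ≡ two) ⇔ (y ≡ x))))
    {g : Fin n → Fin 3} (g-rhf : IsRHF s τ g) (g≤f : g ≤F f) where

    rhf-below-keeps-ones : ∀ {x} → f x ≡ one → g x ≡ one
    rhf-below-keeps-ones {x} fx with g x ≟ one
    ... | yes gx = gx
    ... | no gx≢1 with g-rhf (τ x)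
    ...   | inj₁ (y , y∈ , gy) = ⊥-elim (ones-avoid-twos x fx y y∈ (≤-two (g≤f y) gy))
    ...   | inj₂ (y , τy , gy) with ≤-one (g≤f y) gy
    ...     | inj₁ fy = ⊥-elim (ones-distinct x y fx fy (λ { refl → gx≢1 gy }) (sym τy))
    ...     | inj₂ fy = ⊥-elim (ones-avoid-twos x fx y (subst (λ i → y ∈ s i) τy (corr y)) fy)

    rhf-below-keeps-twos : ∀ {x} → f x ≡ two → g x ≡ two
    rhf-below-keeps-twos {x} fx with twos-private x fx
    ... | i , i≢τx , private-to-x = kept (g-rhf i)
      where
      only-x : ∀ {y} → y ∈ s i → f y ≡ two → y ≡ x
      only-x y∈ fy = Equivalence.to (private-to-x _) (y∈ , fy)

      kept : Covered g i → g x ≡ two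
      kept (inj₁ (y , y∈ , gy)) with only-x y∈ (≤-two (g≤f y) gy)
      ... | refl = gy
      kept (inj₂ (y , τy , gy)) with ≤-one (g≤f y) gy
      ... | inj₁ fy = ⊥-elim (ones-avoid-twos y fy x
                        (subst (λ j → x ∈ s j) (sym τy) (proj₁ (Equivalence.from (private-to-x x) refl))) fx)
      ... | inj₂ fy with only-x (subst (λ j → y ∈ s j) τy (corr y)) fy
      ...   | refl = ⊥-elim (i≢τx (sym τy))

    rhf-below-is-equal : ∀ x → g x ≡ f x
    rhf-below-is-equal x with f x in fx
    ... | zero = ≤-zero (g≤f x) fx
    ... | one = rhf-below-keeps-ones fx
    ... | two = rhf-below-keeps-twos fx

theorem8 : (n m : ℕ) (s : Fin m → Subset n) (τ : Fin n → Fin m) →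
    IsCorrespondence s τ → (f : Fin n → Fin 3) →
    IsMinimalRHF s τ f ⇔
      ((∀ x y → f x ≡ suc zero → f y ≡ suc zero → x ≢ y → τ x ≢ τ y)
      × (∀ x → f x ≡ suc zero → ∀ y → y ∈ s (τ x) → f y ≢ suc (suc zero))
      × (∀ x → f x ≡ suc (suc zero) →
           ∃[ i ] (i ≢ τ x × (∀ y → (y ∈ s i × f y ≡ suc (suc zero)) ⇔ (y ≡ x))))
      × IsMinimalHittingSet s (λ i → ∀ x → τ x ≡ i → f x ≢ suc zero) (preimage2 f))
theorem8 n m s τ corr f = mk⇔
  (λ minimal → minimal⇒ones-distinct-indices s τ minimal
             , minimal⇒ones-sets-avoid-twos s τ minimal
             , minimal⇒twos-have-private-sets s τ minimal
             , minimal⇒twos-minimal-hitting s τ minimal)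
  (λ (ones-distinct , ones-avoid-twos , twos-private , (twos-hitting , _)) →
       hitting⇒rhf s τ ∈-preimage2⁻ twos-hitting
     , λ g g-rhf g≤f → rhf-below-is-equal s τ corr ones-distinct ones-avoid-twos twos-private g-rhf g≤f)
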